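{- Parallel or is not definable in $\ell_{\star\mathsf{P}}$: there is no closed term $M\in\Lambda^0(\{\star,\mathsf{C},\mathsf{P}\})$ such that (i) $M(\mathbf{K}\mathbf{\Omega})\mathbf{\Omega}$ and $M\mathbf{\Omega}(\mathbf{K}\mathbf{\Omega})$ both converge to abstractions, and (ii) $M\star\star\Downarrow\star$.
   Context: $\Lambda^0(\{\star,\mathsf{C},\mathsf{P}\})$ is the set of closed untyped $\lambda$-terms built from variables, abstraction, application and the constants $\star,\mathsf{C},\mathsf{P}$ (modulo $\alpha$-conversion, capture-avoiding substitution). Let $\mathbf{I}\equiv\lambda x.x$, $\mathbf{K}\equiv\mathsf{T}\equiv\lambda x.\lambda y.x$, $\mathsf{F}\equiv\lambda x.\lambda y.y$, $\mathbf{\Omega}\equiv(\lambda x.xx)(\lambda x.xx)$. The evaluation relation $M\Downarrow N$ of $\ell_{\star\mathsf{P}}$ on these closed terms is the least relation closed under: $\lambda x.M\Downarrow\lambda x.M$; if $M\Downarrow\lambda x.P$ and $P[N/x]\Downarrow Q$ then $MN\Downarrow Q$; $\star\Downarrow\star$; $\mathsf{C}\Downarrow\mathsf{C}$; if $M\Downarrow\lambda x.N$ then $\mathsf{C}M\Downarrow\mathsf{T}$; if $M\Downarrow\mathsf{C}$ then $\mathsf{C}M\Downarrow\mathsf{T}$; if $M\Downarrow\star$ then $\mathsf{C}M\Downarrow\mathsf{F}$; $\mathsf{P}\Downarrow\mathsf{P}$; $\mathsf{P}M\Downarrow\mathsf{P}M$; if $M\Downarrow$ then $\mathsf{P}MN\Downarrow\mathbf{I}$;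 if $N\Downarrow$ then $\mathsf{P}MN\Downarrow\mathbf{I}$. Here $M\Downarrow$ means $M\Downarrow N$ for some $N$, and "$M$ converges to an abstraction" means $M\Downarrow\lambda x.N$ for some $x,N$. -}

module Defs where

open import Data.Nat using (ℕ; zero; suc)
open import Data.Fin using (Fin; zero; suc)
open import Data.Product using (Σ; _×_)

-- Untyped λ-terms over the constants ⋆, C, P, in well-scoped de Bruijn form:
-- Tm n = terms with at most n free variables; Tm 0 = closed terms
-- (α-conversion is built in by de Bruijn indices).
data Tm (n : ℕ) : Set where
  var  : Fin n → Tm n
  lam  : Tm (suc n) → Tm n
  app  : Tm n → Tm n → Tm n
  star : Tm n
  cC   : Tm n
  cP   : Tm n

ext : ∀ {n m} → (Fin n → Fin m) → Fin (suc n) → Fin (suc m)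
ext ρ zero    = zero
ext ρ (suc i) = suc (ρ i)

rename : ∀ {n m} → (Fin n → Fin m) → Tm n → Tm m
rename ρ (var i)   = var (ρ i)
rename ρ (lam t)   = lam (rename (ext ρ) t)
rename ρ (app t u) = app (rename ρ t) (rename ρ u)
rename ρ star      = star
rename ρ cC        = cC
rename ρ cP        = cP

exts : ∀ {n m} → (Fin n → Tm m) → Fin (suc n) → Tm (suc m)
exts σ zero    = var zero
exts σ (suc i) = rename suc (σ i)

subst : ∀ {n m} → (Fin n → Tm m) → Tm n → Tm m
subst σ (var i)   = σ i
subst σ (lam t)   = lam (subst (exts σ) t)
subst σ (app t u) = app (subst σ t) (subst σ u)
subst σ star      = star
subst σ cC        = cC
subst σ cP        = cP

_[_] : Tm 1 → Tm 0 → Tm 0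
P [ N ] = subst σ P
  where
  σ : Fin 1 → Tm 0
  σ zero = N

I : ∀ {n} → Tm n
I = lam (var zero)

K : ∀ {n} → Tm n
K = lam (lam (var (suc zero)))

T : ∀ {n} → Tm n
T = K

F : ∀ {n} → Tm n
F = lam (lam (var zero))

Ω : ∀ {n} → Tm n
Ω = app ω ω
  where
  ω : ∀ {n} → Tm n
  ω = lam (app (var zero) (var zero))

infix 4 _⇓_
data _⇓_ : Tm 0 → Tm 0 → Set

_⇓· : Tm 0 → Set
M ⇓· = Σ (Tm 0) (λ N → M ⇓ N)

data _⇓_ where
  ev-lam  : ∀ {M} → lam M ⇓ lam M
  ev-app  : ∀ {M N P Q} → M ⇓ lam P → P [ N ] ⇓ Q → app M N ⇓ Q
  ev-star : star ⇓ star
  ev-C    : cC ⇓ cC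
  ev-Clam : ∀ {M N} → M ⇓ lam N → app cC M ⇓ T
  ev-CC   : ∀ {M} → M ⇓ cC → app cC M ⇓ T
  ev-Cstar : ∀ {M} → M ⇓ star → app cC M ⇓ F
  ev-P    : cP ⇓ cP
  ev-P1   : ∀ {M} → app cP M ⇓ app cP M
  ev-Pl   : ∀ {M N} → M ⇓· → app (app cP M) N ⇓ I
  ev-Pr   : ∀ {M N} → N ⇓· → app (app cP M) N ⇓ I

ConvAbs : Tm 0 → Set
ConvAbs M = Σ (Tm 1) (λ N → M ⇓ lam N)

module Submission where

-- Proof idea: a candidate M would make the three terms
--   M (KΩ) Ω,   M Ω (KΩ),   M ⋆ ⋆
-- all converge, the first two to abstractions and the last to ⋆. These
-- terms are "related": they agree everywhere except at hole positions
-- where the first two carry the pair (KΩ, Ω) or (Ω, KΩ) and the third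
-- carries ⋆. In every hole one of the first two fillers diverges, so a
-- simultaneous convergence can never inspect a hole: the evaluations of
-- related terms run in lock step, and the C and P primitives only look at
-- the outermost constructor of a value, which related values share.
--
-- The theorem follows
-- because an abstraction, an abstraction and ⋆ are never related.

open import Defs
open import Data.Product using (Σ; _×_; _,_)
open import Data.Nat using (ℕ)
open import Data.Fin using (Fin; zero; suc)
open import Data.Empty using (⊥-elim)
open import Relation.Nullary using (¬_)
open import Relation.Binary.PropositionalEquality using (_≡_; refl)

data Related {n : ℕ} : Tm n → Tm n → Tm n → Set where
  r-var  : ∀ i → Related (var i) (var i) (var i)
  r-lam  : ∀ {t u v} → Related t u v → Related (lam t) (lam u) (lam v)
  r-app  : ∀ {t u v t' u' v'} → Related t u v → Related t' u' v' →
           Related (app t t') (app u u') (app v v')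
  r-star : Related star star star
  r-C    : Related cC cC cC
  r-P    : Related cP cP cP
  r-holeˡ : Related (app K Ω) Ω star
  r-holeʳ : Related Ω (app K Ω) star

related-refl : ∀ {n} (t : Tm n) → Related t t t
related-refl (var i)   = r-var i
related-refl (lam t)   = r-lam (related-refl t)
related-refl (app t u) = r-app (related-refl t) (related-refl u)
related-refl star      = r-star
related-refl cC        = r-C
related-refl cP        = r-P

-- Holes are closed, so renaming leaves them untouched.
related-rename : ∀ {n m} (ρ : Fin n → Fin m) {a b c} → Related a b c →
                 Related (rename ρ a) (rename ρ b) (rename ρ c)
related-rename ρ (r-var i)   = r-var (ρ i)
related-rename ρ (r-lam h)   = r-lam (related-rename (ext ρ) h)
related-rename ρ (r-app h k) = r-app (related-rename ρ h) (related-rename ρ k)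
related-rename ρ r-star      = r-star
related-rename ρ r-C         = r-C
related-rename ρ r-P         = r-P
related-rename ρ r-holeˡ     = r-holeˡ
related-rename ρ r-holeʳ     = r-holeʳ

related-subst : ∀ {n m} {σ₁ σ₂ σ₃ : Fin n → Tm m} →
                (∀ i → Related (σ₁ i) (σ₂ i) (σ₃ i)) →
                ∀ {a b c} → Related a b c →
                Related (subst σ₁ a) (subst σ₂ b) (subst σ₃ c)
related-subst hσ (r-var i)   = hσ i
related-subst {σ₁ = σ₁} {σ₂} {σ₃} hσ (r-lam h) = r-lam (related-subst hσ' h)
  where
  hσ' : ∀ i → Related (exts σ₁ i) (exts σ₂ i) (exts σ₃ i)
  hσ' zero    = r-var zero
  hσ' (suc i) = related-rename suc (hσ i)
related-subst hσ (r-app h k) = r-app (related-subst hσ h) (related-subst hσ k)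
related-subst hσ r-star      = r-star
related-subst hσ r-C         = r-C
related-subst hσ r-P         = r-P
related-subst hσ r-holeˡ     = r-holeˡ
related-subst hσ r-holeʳ     = r-holeʳ

related-inst : ∀ {P Q R a b c} → Related P Q R → Related a b c →
               Related (P [ a ]) (Q [ b ]) (R [ c ])
related-inst h k = related-subst (λ { zero → k }) h

Ω-diverges : ∀ {v} → ¬ (Ω ⇓ v)
Ω-diverges (ev-app ev-lam d) = Ω-diverges d

data Value : Tm 0 → Set where
  v-lam  : ∀ {t} → Value (lam t)
  v-star : Value star
  v-C    : Value cC
  v-P    : Value cP
  v-P1   : ∀ {t} → Value (app cP t)

⇓-value : ∀ {M v} → M ⇓ v → Value v
⇓-value ev-lam       = v-lam
⇓-value (ev-app _ d) = ⇓-value d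
⇓-value ev-star      = v-star
⇓-value ev-C         = v-C
⇓-value (ev-Clam _)  = v-lam
⇓-value (ev-CC _)    = v-lam
⇓-value (ev-Cstar _) = v-lam
⇓-value ev-P         = v-P
⇓-value ev-P1        = v-P1
⇓-value (ev-Pl _)    = v-lam
⇓-value (ev-Pr _)    = v-lam

-- The answer C gives on an argument with value v (junk on non-values).
C-test : Tm 0 → Tm 0
C-test (lam _) = T
C-test cC      = T
C-test star    = F
C-test _       = I

P1-inversion : ∀ {M v} → app cP M ⇓ v → v ≡ app cP M
P1-inversion (ev-app () _)
P1-inversion ev-P1 = refl

P2-inversion : ∀ {M N v} → app (app cP M) N ⇓ v → v ≡ I
P2-inversion (ev-app (ev-app () _) _)
P2-inversion (ev-Pl _) = refl
P2-inversion (ev-Pr _) = refl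

-- Related values share their outermost constructor, so C cannot tell them
-- apart. (Holes are excluded because they are not values.)
C-test-related : ∀ {a b c} → Related a b c → Value a →
                 C-test a ≡ C-test c × C-test b ≡ C-test c
C-test-related (r-lam _)           _  = refl , refl
C-test-related r-star              _  = refl , refl
C-test-related r-C                 _  = refl , refl
C-test-related r-P                 _  = refl , refl
C-test-related (r-app r-P _)       _  = refl , refl
C-test-related (r-app (r-var _) _) ()
C-test-related (r-app (r-lam _) _) ()

-- Fundamental lemma: if three related terms all converge, their values are
-- related. A hole can never be evaluated, since one of its first two
-- fillers is Ω.
related-values : ∀ {a b c va vb vc} → Related a b c →
                 a ⇓ va → b ⇓ vb → c ⇓ vc → Related va vb vc

-- An evaluation of C M consists of an
-- evaluation of M to some w, with result C-test w; the three evaluations are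
-- unpacked one at a time (so that the recursion stays structural), and then
-- the arguments' values agree on the C-test by C-test-related.
C-relatedᵃ : ∀ {a b c va vb vc} → Related a b c →
             app cC a ⇓ va → app cC b ⇓ vb → app cC c ⇓ vc → Related va vb vc
C-relatedᵇ : ∀ {a b c wa vb vc} → Related a b c →
             a ⇓ wa → app cC b ⇓ vb → app cC c ⇓ vc → Related (C-test wa) vb vc
C-relatedᶜ : ∀ {a b c wa wb vc} → Related a b c →
             a ⇓ wa → b ⇓ wb → app cC c ⇓ vc →
             Related (C-test wa) (C-test wb) vc
C-tests-related : ∀ {a b c wa wb wc} → Related a b c →
                  a ⇓ wa → b ⇓ wb → c ⇓ wc →
                  Related (C-test wa) (C-test wb) (C-test wc)

C-relatedᵃ h (ev-app () _) _ _
C-relatedᵃ h (ev-Clam d)  db dc = C-relatedᵇ h d db dc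
C-relatedᵃ h (ev-CC d)    db dc = C-relatedᵇ h d db dc
C-relatedᵃ h (ev-Cstar d) db dc = C-relatedᵇ h d db dc

C-relatedᵇ h d (ev-app () _) _
C-relatedᵇ h d (ev-Clam e)  dc = C-relatedᶜ h d e dc
C-relatedᵇ h d (ev-CC e)    dc = C-relatedᶜ h d e dc
C-relatedᵇ h d (ev-Cstar e) dc = C-relatedᶜ h d e dc

C-relatedᶜ h d e (ev-app () _)
C-relatedᶜ h d e (ev-Clam f)  = C-tests-related h d e f
C-relatedᶜ h d e (ev-CC f)    = C-tests-related h d e f
C-relatedᶜ h d e (ev-Cstar f) = C-tests-related h d e f

C-tests-related {wc = wc} h d e f
  with C-test-related (related-values h d e f) (⇓-value d)
... | agreeᵃ , agreeᵇ rewrite agreeᵃ | agreeᵇ = related-refl (C-test wc)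

related-values r-holeˡ _ db _ = ⊥-elim (Ω-diverges db)
related-values r-holeʳ da _ _ = ⊥-elim (Ω-diverges da)
related-values (r-lam h) ev-lam ev-lam ev-lam = r-lam h
related-values r-star ev-star ev-star ev-star = r-star
related-values r-C ev-C ev-C ev-C = r-C
related-values r-P ev-P ev-P ev-P = r-P
related-values (r-app r-C h) da db dc = C-relatedᵃ h da db dc
related-values (r-app r-P h) da db dc
  rewrite P1-inversion da | P1-inversion db | P1-inversion dc = r-app r-P h
related-values (r-app (r-app r-P _) _) da db dc
  rewrite P2-inversion da | P2-inversion db | P2-inversion dc = related-refl I
related-values (r-app h k) (ev-app da da') (ev-app db db') (ev-app dc dc')
  with related-values h da db dc
... | r-lam hbody = related-values (related-inst hbody k) da' db' dc'

mainTheorem19 : ¬ Σ (Tm 0) (λ M →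
                  (ConvAbs (app (app M (app K Ω)) Ω)
                   × ConvAbs (app (app M Ω) (app K Ω)))
                  × (app (app M star) star ⇓ star))
mainTheorem19 (M , ((_ , converges₁) , (_ , converges₂)) , converges⋆)
  with related-values (r-app (r-app (related-refl M) r-holeˡ) r-holeʳ)
                      converges₁ converges₂ converges⋆
... | ()
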